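{- Let $N_1,N_2>0$. Let $\{\alpha_1,\dots,\alpha_g\}$ be the Lyndon basis of $\mathbf F_{N_1,2}$ and $\{\beta_1,\dots,\beta_h\}$ the Lyndon basis of $\mathbf F_{N_2,2}$. Then the set $\{\alpha_i\,\text{ш}\,\beta_j\mid1\le i\le g,\ 1\le j\le h\}$ is linearly independent over $\mathbb Q$, and the set $\{\alpha_i\,\text{ш}\,\alpha_j\mid1\le i\le j\le g\}$ is linearly independent over $\mathbb Q$.
   Context: $\mathbf F=\mathbb Q\langle z_3,z_5,z_7,\dots\rangle$ (noncommutative polynomials, empty word $=1$); $\mathbf F_{N,r}$ is the $\mathbb Q$-span of words $z_{n_1}\cdots z_{n_r}$ with $\sum n_i=N$, all $n_i$ odd $\ge3$. The shuffle product ш is bilinear with $z_{n_1}\cdots z_{n_r}\,\text{ш}\,z_{n_{r+1}}\cdots z_{n_{r+s}}=\sum_\sigma z_{n_{\sigma^{ -1}(1)}}\cdots z_{n_{\sigma^{ -1}(r+s)}}$ over permutations $\sigma$ of $\{1,\dots,r+s\}$ with $\sigma(1)<\cdots<\sigma(r)$, $\sigma(r+1)<\cdots<\sigma(r+s)$. Order the letters by $z_a<z_b$ iff $a<b$; a Lyndon word is a nonempty word strictly smaller in lexicographic order than each of its proper nonempty right factors; $(\mathbf F,\text{ш})$ is a polynomial algebra on the Lyndon words, and the Lyndon basis of $\mathbf F_{N,r}$ is the basis of shuffle-monomials in Lyndon words lying in $\mathbf F_{N,r}$. Explicitly, the Lyndon basis of $\mathbf F_{N,2}$ is $\{z_{n_1}z_{n_2}: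 n_1+n_2=N,\ n_i\text{ odd}\ge3,\ n_1<n_2\}\cup\{z_{n_1}\,\text{ш}\,z_{n_2}: n_1+n_2=N,\ n_i\text{ odd}\ge3,\ n_1\le n_2\}$. -}

module Defs where

open import Data.Nat using (ℕ; zero; suc; _≤_; _<_; _∸_; _%_; _≡ᵇ_; _<ᵇ_; _≤ᵇ_)
open import Data.Bool using (Bool; true; false; _∧_; if_then_else_)
open import Data.List using (List; []; _∷_; _++_; map; concatMap; upTo; length; lookup; allFin)
open import Data.List.Properties using () renaming (≡-dec to listDec)
open import Data.Product using (_×_; _,_; ∃; ∃-syntax)
open import Data.Fin using (Fin)
import Data.Nat as ℕ
open import Data.Rational using (ℚ; 0ℚ; 1ℚ; _+_; _*_)
open import Relation.Binary.PropositionalEquality using (_≡_; _≢_)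
open import Relation.Nullary using (¬_; yes; no)

-- A word z_{n_1} ... z_{n_r} is represented by the list of indices [n_1, ..., n_r].
Word : Set
Word = List ℕ

-- An element of F (a Q-linear combination of words) is represented by a finite
-- formal sum: a list of (coefficient, word) pairs.
Poly : Set
Poly = List (ℚ × Word)

coeff : Poly → Word → ℚ
coeff [] w = 0ℚ
coeff ((q , u) ∷ p) w with listDec ℕ._≟_ u w
... | yes _ = q + coeff p w
... | no  _ = coeff p w

_≈P_ : Poly → Poly → Set
p ≈P q = ∀ w → coeff p w ≡ coeff q w

IsZeroP : Poly → Set
IsZeroP p = ∀ w → coeff p w ≡ 0ℚ

mono : Word → Poly
mono w = (1ℚ , w) ∷ []

scale : ℚ → Poly → Poly
scale c p = map (λ { (q , w) → (c * q , w) }) p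

shW : Word → Word → List Word
shW [] v = v ∷ []
shW (a ∷ u) [] = (a ∷ u) ∷ []
shW (a ∷ u) (b ∷ v) = map (a ∷_) (shW u (b ∷ v)) ++ map (b ∷_) (shW (a ∷ u) v)

_ш_ : Poly → Poly → Poly
p ш q = concatMap (λ { (a , u) → concatMap (λ { (b , v) → map (λ w → (a * b , w)) (shW u v) }) q }) p

oddGe3 : ℕ → Bool
oddGe3 n = (n % 2 ≡ᵇ 1) ∧ (3 ≤ᵇ n)

-- Lyndon basis of F_{N,2}, as an explicit list (enumeration order: first the
-- words z_{n1} z_{n2} with n1 < n2, then the shuffles z_{n1} ш z_{n2} with n1 ≤ n2;
-- in both cases n1 + n2 = N, n_i odd ≥ 3).
lyndonBasis2 : ℕ → List Poly
lyndonBasis2 N =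
  concatMap (λ n₁ → if oddGe3 n₁ ∧ oddGe3 (N ∸ n₁) ∧ (n₁ <ᵇ (N ∸ n₁))
                      then mono (n₁ ∷ (N ∸ n₁) ∷ []) ∷ [] else [])
            (upTo (suc N))
  ++
  concatMap (λ n₁ → if oddGe3 n₁ ∧ oddGe3 (N ∸ n₁) ∧ (n₁ ≤ᵇ (N ∸ n₁))
                      then (mono (n₁ ∷ []) ш mono ((N ∸ n₁) ∷ [])) ∷ [] else [])
            (upTo (suc N))

linComb : {k : ℕ} → (Fin k → ℚ) → (Fin k → Poly) → Poly
linComb {k} c v = concatMap (λ i → scale (c i) (v i)) (allFin k)

LinIndepSet : (Poly → Set) → Set
LinIndepSet S =
  ∀ (k : ℕ) (v : Fin k → Poly) (c : Fin k → ℚ) →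
  (∀ i → S (v i)) →
  (∀ i j → i ≢ j → ¬ (v i ≈P v j)) →
  IsZeroP (linComb c v) →
  ∀ i → c i ≡ 0ℚ

-- A basis element of F_{N,2} is z_a z_b (a < b) or z_a ш z_b, a shuffle of Lyndon words, so
-- every product α ш β is a shuffle of two to four Lyndon words: a sum of words of length four
-- with coefficient one. Its lexicographically largest word is the concatenation of these
-- Lyndon words in decreasing order, so the Lyndon factorisation of that word recovers α ш β.
-- The products are therefore triangular with respect to their largest words, hence linearly
-- independent. The recovery depends only on the relative order of the four letters: replacing
-- each letter by its rank turns it into a finite statement about letters < 4, decided by
-- evaluation.
module Submission where

open import Defs
open import Level using (0ℓ)
open import Data.Bool using (true; T; if_then_else_; _∧_)
open import Data.Bool.Properties using (T-∧)
open import Data.Fin as Fin using (Fin)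
open import Data.Fin.Properties using (punchInᵢ≢i)
open import Data.List
  using (List; []; _∷_; _++_; map; concatMap; tabulate; allFin; filter; length; lookup; upTo)
open import Data.List.Properties
  using (≡-dec; ∷-injectiveˡ; ∷-injectiveʳ; ++-identityʳ; ++-assoc; map-++; map-∘; map-id;
         concatMap-map; map-concatMap; concatMap-cong)
open import Data.List.Membership.Propositional using (_∈_; _∉_; find; lose)
open import Data.List.Membership.Propositional.Properties
  using (∈-map⁺; ∈-map⁻; ∈-filter⁺; ∈-allFin; ∈-++⁻; ∈-++⁺ˡ; ∈-concatMap⁺; ∈-concatMap⁻;
         ∈-lookup)
open import Data.List.Relation.Binary.Permutation.Propositional as ↭ using (_↭_)
open import Data.List.Relation.Binary.Permutation.Propositional.Properties
  using (map⁺; shift; ++⁺; ∈-resp-↭; ↭-length)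
open import Data.List.Relation.Binary.Pointwise using (Pointwise-≡⇒≡)
import Data.List.Relation.Binary.Lex.Strict as Lex
open import Data.List.Relation.Unary.Any using (here; there)
open import Data.List.Relation.Unary.All as All using (All; []; _∷_)
open import Data.List.Relation.Unary.All.Properties as All using (all-filter; ++⁻ˡ; ++⁻ʳ)
open import Data.Nat using (ℕ; zero; suc; _≤_; _<_; _<?_; z≤n; s≤s; _∸_; _<ᵇ_; _≤ᵇ_; _≟_)
open import Data.List.Membership.DecPropositional (≡-dec _≟_) using (_∈?_)
open import Data.Nat.Properties
  using (<-strictTotalOrder; <-cmp; <-trans; <-≤-trans; <-irrefl; <⇒≤; <⇒≢; m≤n⇒m≤1+n;
         <ᵇ⇒<; allUpTo?)
open import Data.Product using (_×_; _,_; proj₂; ∃-syntax)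
open import Data.Rational using (ℚ; 0ℚ; 1ℚ; _+_; _*_; 1/_; ≢-nonZero)
  renaming (_≤_ to _≤ℚ_; _<_ to _<ℚ_)
import Data.Rational.Properties as ℚ
open import Algebra.Properties.CommutativeMonoid.Sum ℚ.+-0-commutativeMonoid
  using (sum; sum-remove; sum-cong-≗; sum-replicate-zero)
open import Data.Sum using (inj₁; inj₂)
open import Data.Unit using (⊤; tt)
open import Data.Vec.Functional using (removeAt)
open import Function using (id; _∘_)
open import Function.Bundles using (Equivalence)
open import Relation.Binary using (tri<; tri≈; tri>)
open import Relation.Binary.Bundles using (DecTotalOrder)
open import Relation.Binary.PropositionalEquality
  using (_≡_; _≢_; refl; sym; trans; cong; cong₂; subst; module ≡-Reasoning)
open import Relation.Nullary using (Dec; yes; no; ¬?; does; contradiction)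
open import Relation.Nullary.Decidable using (_×-dec_; _→-dec_; map′; toWitness)

-- Lexicographic order and largest words

wordOrder : DecTotalOrder 0ℓ 0ℓ 0ℓ
wordOrder = Lex.≤-decTotalOrder <-strictTotalOrder

open DecTotalOrder wordOrder using (totalOrder)
  renaming (_≤_ to _≤ʷ_; _≤?_ to _≤ʷ?_; refl to ≤ʷ-refl; antisym to ≤ʷ-antisym)
open import Data.List.Extrema totalOrder
  using (max; argmax; argmax-sel; argmax-all; f[xs]≤f[argmax]; v≤max⁺; max≤v⁺)
open import Data.List.Sort.InsertionSort wordOrder using (sort)
open import Data.List.Sort.InsertionSort.Properties wordOrder using (sort-↭)

StrictlyMonotoneOn : (ℕ → Set) → (ℕ → ℕ) → Set
StrictlyMonotoneOn Q r = ∀ {x y} → Q x → Q y → x < y → r x < r y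

InjectiveOn : {A B : Set} → (A → Set) → (A → B) → Set
InjectiveOn G f = ∀ {x y} → G x → G y → f x ≡ f y → x ≡ y

strictlyMonotone⇒injective : ∀ {Q r} → StrictlyMonotoneOn Q r → InjectiveOn Q r
strictlyMonotone⇒injective r-mono {x} {y} Qx Qy rx≡ry with <-cmp x y
... | tri< x<y _ _ = contradiction rx≡ry (<⇒≢ (r-mono Qx Qy x<y))
... | tri≈ _ x≡y _ = x≡y
... | tri> _ _ y<x = contradiction (sym rx≡ry) (<⇒≢ (r-mono Qy Qx y<x))

map-injectiveOn : ∀ {Q} {r : ℕ → ℕ} → InjectiveOn Q r → InjectiveOn (All Q) (map r)
map-injectiveOn r-inj [] [] refl = refl
map-injectiveOn r-inj (Qx ∷ Qu) (Qy ∷ Qv) eq =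
  cong₂ _∷_ (r-inj Qx Qy (∷-injectiveˡ eq)) (map-injectiveOn r-inj Qu Qv (∷-injectiveʳ eq))

map-mono-≤ʷ : ∀ {Q r} → StrictlyMonotoneOn Q r →
  ∀ {u v} → All Q u → All Q v → u ≤ʷ v → map r u ≤ʷ map r v
map-mono-≤ʷ r-mono [] [] (Lex.base tt) = Lex.base tt
map-mono-≤ʷ r-mono [] (_ ∷ _) Lex.halt = Lex.halt
map-mono-≤ʷ r-mono (Qx ∷ _) (Qy ∷ _) (Lex.this x<y) = Lex.this (r-mono Qx Qy x<y)
map-mono-≤ʷ r-mono (_ ∷ Qu) (_ ∷ Qv) (Lex.next refl u≤v) = Lex.next refl (map-mono-≤ʷ r-mono Qu Qv u≤v)

maxWord : List Word → Word
maxWord [] = []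
maxWord (w ∷ ws) = max w ws

maxWord-∈ : ∀ {w ws} → w ∈ ws → maxWord ws ∈ ws
maxWord-∈ {ws = u ∷ us} _ with argmax-sel id u us
... | inj₁ max≡u = here max≡u
... | inj₂ max∈us = there max∈us

≤-maxWord : ∀ {w ws} → w ∈ ws → w ≤ʷ maxWord ws
≤-maxWord {ws = u ∷ us} (here refl) = v≤max⁺ u us (inj₁ ≤ʷ-refl)
≤-maxWord {ws = u ∷ us} (there w∈us) = v≤max⁺ u us (inj₂ (lose w∈us ≤ʷ-refl))

maxWord-unique : ∀ {w ws} → w ∈ ws → All (_≤ʷ w) ws → maxWord ws ≡ w
maxWord-unique {ws = u ∷ us} w∈ws (u≤w ∷ us≤w) =
  Pointwise-≡⇒≡ (≤ʷ-antisym (max≤v⁺ u≤w us≤w) (≤-maxWord w∈ws))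

maxWord-map : ∀ {Q r} → StrictlyMonotoneOn Q r →
  ∀ {ws} → All (All Q) ws → maxWord (map (map r) ws) ≡ map r (maxWord ws)
maxWord-map r-mono [] = refl
maxWord-map {r = r} r-mono {ws} Qws@(_ ∷ _) =
  maxWord-unique (∈-map⁺ (map r) max∈ws)
    (All.map⁺ (All.tabulate λ w∈ws →
      map-mono-≤ʷ r-mono (All.lookup Qws w∈ws) (All.lookup Qws max∈ws) (≤-maxWord w∈ws)))
  where
  max∈ws : maxWord ws ∈ ws
  max∈ws = maxWord-∈ (here refl)

-- Coefficients and triangular families

coeff-++ : ∀ p q w → coeff (p ++ q) w ≡ coeff p w + coeff q w
coeff-++ [] q w = sym (ℚ.+-identityˡ _)
coeff-++ ((a , u) ∷ p) q w with ≡-dec _≟_ u w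
... | yes _ = trans (cong (a +_) (coeff-++ p q w)) (sym (ℚ.+-assoc a _ _))
... | no _ = coeff-++ p q w

coeff-scale : ∀ c p w → coeff (scale c p) w ≡ c * coeff p w
coeff-scale c [] w = sym (ℚ.*-zeroʳ c)
coeff-scale c ((a , u) ∷ p) w with ≡-dec _≟_ u w
... | yes _ = trans (cong (c * a +_) (coeff-scale c p w)) (sym (ℚ.*-distribˡ-+ c a _))
... | no _ = coeff-scale c p w

coeff-↭ : ∀ {p q} w → p ↭ q → coeff p w ≡ coeff q w
coeff-↭ w ↭.refl = refl
coeff-↭ w (↭.prep t p↭q) = trans (coeff-++ (t ∷ []) _ w)
  (trans (cong (coeff (t ∷ []) w +_) (coeff-↭ w p↭q)) (sym (coeff-++ (t ∷ []) _ w)))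
coeff-↭ w (↭.swap {p} {q} s t p↭q) = begin
  coeff (s ∷ t ∷ p) w                ≡⟨ coeff-++ (s ∷ []) _ w ⟩
  cs + coeff (t ∷ p) w               ≡⟨ cong (cs +_) (coeff-++ (t ∷ []) p w) ⟩
  cs + (ct + coeff p w)              ≡⟨ sym (ℚ.+-assoc cs ct _) ⟩
  (cs + ct) + coeff p w              ≡⟨ cong₂ _+_ (ℚ.+-comm cs ct) (coeff-↭ w p↭q) ⟩
  (ct + cs) + coeff q w              ≡⟨ ℚ.+-assoc ct cs _ ⟩
  ct + (cs + coeff q w)              ≡⟨ cong (ct +_) (sym (coeff-++ (s ∷ []) q w)) ⟩
  ct + coeff (s ∷ q) w               ≡⟨ sym (coeff-++ (t ∷ []) _ w) ⟩
  coeff (t ∷ s ∷ q) w                ∎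
  where
  open ≡-Reasoning
  cs = coeff (s ∷ []) w
  ct = coeff (t ∷ []) w
coeff-↭ w (↭.trans p↭q q↭r) = trans (coeff-↭ w p↭q) (coeff-↭ w q↭r)

*-≢0 : ∀ {p q} → p ≢ 0ℚ → q ≢ 0ℚ → p * q ≢ 0ℚ
*-≢0 {p} {q} p≢0 q≢0 pq≡0 = q≢0 (begin
  q                ≡⟨ sym (ℚ.*-identityˡ q) ⟩
  1ℚ * q           ≡⟨ cong (_* q) (sym (ℚ.*-inverseˡ p)) ⟩
  (1/ p * p) * q   ≡⟨ ℚ.*-assoc (1/ p) p q ⟩
  1/ p * (p * q)   ≡⟨ cong (1/ p *_) pq≡0 ⟩
  1/ p * 0ℚ        ≡⟨ ℚ.*-zeroʳ (1/ p) ⟩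
  0ℚ               ∎)
  where
  open ≡-Reasoning
  instance _ = ≢-nonZero p≢0

wordSum : List Word → Poly
wordSum = map (1ℚ ,_)

coeff-wordSum-∉ : ∀ {w} ws → w ∉ ws → coeff (wordSum ws) w ≡ 0ℚ
coeff-wordSum-∉ [] _ = refl
coeff-wordSum-∉ {w} (u ∷ ws) w∉ws with ≡-dec _≟_ u w
... | yes refl = contradiction (here refl) w∉ws
... | no _ = coeff-wordSum-∉ ws (w∉ws ∘ there)

coeff-wordSum-nonneg : ∀ ws w → 0ℚ ≤ℚ coeff (wordSum ws) w
coeff-wordSum-nonneg [] w = ℚ.≤-refl
coeff-wordSum-nonneg (u ∷ ws) w with ≡-dec _≟_ u w
... | yes _ = ℚ.+-mono-≤ {0ℚ} {1ℚ} {0ℚ} (ℚ.<⇒≤ (ℚ.positive⁻¹ 1ℚ)) (coeff-wordSum-nonneg ws w)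
... | no _ = coeff-wordSum-nonneg ws w

coeff-wordSum-pos : ∀ {w ws} → w ∈ ws → 0ℚ <ℚ coeff (wordSum ws) w
coeff-wordSum-pos {w} {u ∷ ws} w∈ws with ≡-dec _≟_ u w | w∈ws
... | yes _ | _ = ℚ.+-mono-<-≤ {0ℚ} {1ℚ} {0ℚ} (ℚ.positive⁻¹ 1ℚ) (coeff-wordSum-nonneg ws w)
... | no u≢w | here w≡u = contradiction (sym w≡u) u≢w
... | no _ | there w∈ws′ = coeff-wordSum-pos w∈ws′

coeff-wordSum-∈ : ∀ {w ws} → w ∈ ws → coeff (wordSum ws) w ≢ 0ℚ
coeff-wordSum-∈ w∈ws c≡0 = ℚ.<-irrefl (sym c≡0) (coeff-wordSum-pos w∈ws)

coeff-wordSum-map : ∀ {G f} → InjectiveOn G f → ∀ {w ws} → G w → All G ws →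
  coeff (wordSum (map f ws)) (f w) ≡ coeff (wordSum ws) w
coeff-wordSum-map f-inj Gw [] = refl
coeff-wordSum-map {f = f} f-inj {w} {u ∷ ws} Gw (Gu ∷ Gws)
  with ≡-dec _≟_ (f u) (f w) | ≡-dec _≟_ u w
... | yes _ | yes _ = cong (1ℚ +_) (coeff-wordSum-map f-inj Gw Gws)
... | no _ | no _ = coeff-wordSum-map f-inj Gw Gws
... | yes fu≡fw | no u≢w = contradiction (f-inj Gu Gw fu≡fw) u≢w
... | no fu≢fw | yes refl = contradiction refl fu≢fw

wordSum-reflects-↭ : ∀ {G f} → InjectiveOn G f → ∀ {us vs} → All G us → All G vs →
  map f us ↭ map f vs → wordSum us ≈P wordSum vs
wordSum-reflects-↭ {G} {f} f-inj {us} {vs} Gus Gvs fus↭fvs w = by-membership (w ∈? us) (w ∈? vs)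
  where
  transfer : G w → coeff (wordSum us) w ≡ coeff (wordSum vs) w
  transfer Gw = begin
    coeff (wordSum us) w              ≡⟨ sym (coeff-wordSum-map f-inj Gw Gus) ⟩
    coeff (wordSum (map f us)) (f w)  ≡⟨ coeff-↭ (f w) (map⁺ (1ℚ ,_) fus↭fvs) ⟩
    coeff (wordSum (map f vs)) (f w)  ≡⟨ coeff-wordSum-map f-inj Gw Gvs ⟩
    coeff (wordSum vs) w              ∎
    where open ≡-Reasoning
  by-membership : Dec (w ∈ us) → Dec (w ∈ vs) → coeff (wordSum us) w ≡ coeff (wordSum vs) w
  by-membership (yes w∈us) _ = transfer (All.lookup Gus w∈us)
  by-membership (no _) (yes w∈vs) = transfer (All.lookup Gvs w∈vs)
  by-membership (no w∉us) (no w∉vs) = trans (coeff-wordSum-∉ us w∉us) (sym (coeff-wordSum-∉ vs w∉vs))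

coeff-wordSum-≢0⇒∈ : ∀ {w} ws → coeff (wordSum ws) w ≢ 0ℚ → w ∈ ws
coeff-wordSum-≢0⇒∈ {w} ws c≢0 with w ∈? ws
... | yes w∈ws = w∈ws
... | no w∉ws = contradiction (coeff-wordSum-∉ ws w∉ws) c≢0

coeff-concatMap-tabulate : ∀ {A : Set} {k} (g : A → Poly) (h : Fin k → A) w →
  coeff (concatMap g (tabulate h)) w ≡ sum (λ l → coeff (g (h l)) w)
coeff-concatMap-tabulate {k = zero} g h w = refl
coeff-concatMap-tabulate {k = suc k} g h w =
  trans (coeff-++ (g (h Fin.zero)) _ w)
    (cong (coeff (g (h Fin.zero)) w +_) (coeff-concatMap-tabulate g (h ∘ Fin.suc) w))

coeff-linComb : ∀ {k} (c : Fin k → ℚ) v w → coeff (linComb c v) w ≡ sum (λ l → c l * coeff (v l) w)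
coeff-linComb c v w = trans (coeff-concatMap-tabulate (λ l → scale (c l) (v l)) (λ l → l) w)
  (sum-cong-≗ (λ l → coeff-scale (c l) (v l) w))

sum-single : ∀ {k} (t : Fin k → ℚ) j → (∀ l → l ≢ j → t l ≡ 0ℚ) → sum t ≡ t j
sum-single {suc k} t j t-off-j = begin
  sum t                         ≡⟨ sum-remove t ⟩
  t j + sum (removeAt t j)      ≡⟨ cong (t j +_) removed-zero ⟩
  t j + 0ℚ                      ≡⟨ ℚ.+-identityʳ (t j) ⟩
  t j                           ∎
  where
  open ≡-Reasoning
  removed-zero : sum (removeAt t j) ≡ 0ℚ
  removed-zero = trans (sum-cong-≗ (λ l → t-off-j _ (punchInᵢ≢i j l))) (sum-replicate-zero k)

linIndep-triangular : (S : Poly → Set) (lead : Poly → Word) →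
  (∀ {p} → S p → coeff p (lead p) ≢ 0ℚ) →
  (∀ {p q} → S p → S q → coeff q (lead p) ≢ 0ℚ → lead p ≤ʷ lead q) →
  (∀ {p q} → S p → S q → lead p ≡ lead q → p ≈P q) →
  LinIndepSet S
linIndep-triangular S lead lead-coeff lead-max lead-inj k v c Sv distinct vanishes i
  with c i ℚ.≟ 0ℚ
... | yes cᵢ≡0 = cᵢ≡0
... | no cᵢ≢0 = contradiction coeff-at-w≡0 (*-≢0 cⱼ≢0 (lead-coeff (Sv j)))
  where
  nonzero? : ∀ l → Dec (c l ≢ 0ℚ)
  nonzero? l = ¬? (c l ℚ.≟ 0ℚ)
  support : List (Fin k)
  support = filter nonzero? (allFin k)
  j : Fin k
  j = argmax (lead ∘ v) i support
  cⱼ≢0 : c j ≢ 0ℚ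
  cⱼ≢0 = argmax-all (lead ∘ v) {P = λ l → c l ≢ 0ℚ} cᵢ≢0 (all-filter nonzero? (allFin k))
  j-maximal : ∀ l → c l ≢ 0ℚ → lead (v l) ≤ʷ lead (v j)
  j-maximal l cₗ≢0 = All.lookup (f[xs]≤f[argmax] i support) (∈-filter⁺ nonzero? (∈-allFin l) cₗ≢0)
  w : Word
  w = lead (v j)
  term : Fin k → ℚ
  term l = c l * coeff (v l) w
  term-off-j : ∀ l → l ≢ j → term l ≡ 0ℚ
  term-off-j l l≢j with c l ℚ.≟ 0ℚ | coeff (v l) w ℚ.≟ 0ℚ
  ... | yes cₗ≡0 | _ = trans (cong (_* coeff (v l) w) cₗ≡0) (ℚ.*-zeroˡ (coeff (v l) w))
  ... | _ | yes coeff≡0 = trans (cong (c l *_) coeff≡0) (ℚ.*-zeroʳ (c l))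
  ... | no cₗ≢0 | no coeff≢0 = contradiction
    (lead-inj (Sv j) (Sv l)
      (Pointwise-≡⇒≡ (≤ʷ-antisym (lead-max (Sv j) (Sv l) coeff≢0) (j-maximal l cₗ≢0))))
    (distinct j l (l≢j ∘ sym))
  coeff-at-w≡0 : term j ≡ 0ℚ
  coeff-at-w≡0 = trans (sym (sum-single term j term-off-j))
    (trans (sym (coeff-linComb c v w)) (vanishes w))

-- Shuffles

shW-↭ : ∀ u v {x} → x ∈ shW u v → x ↭ u ++ v
shW-↭ [] v (here refl) = ↭.refl
shW-↭ (a ∷ u) [] (here refl) = ↭.↭-reflexive (cong (a ∷_) (sym (++-identityʳ u)))
shW-↭ (a ∷ u) (b ∷ v) x∈ with ∈-++⁻ (map (a ∷_) (shW u (b ∷ v))) x∈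
... | inj₁ x∈left with ∈-map⁻ (a ∷_) x∈left
...   | y , y∈ , refl = ↭.prep a (shW-↭ u (b ∷ v) y∈)
shW-↭ (a ∷ u) (b ∷ v) x∈ | inj₂ x∈right with ∈-map⁻ (b ∷_) x∈right
...   | y , y∈ , refl = ↭.trans (↭.prep b (shW-↭ (a ∷ u) v y∈)) (↭.↭-sym (shift b (a ∷ u) v))

++-∈-shW : ∀ u v → u ++ v ∈ shW u v
++-∈-shW [] v = here refl
++-∈-shW (a ∷ u) [] = here (cong (a ∷_) (++-identityʳ u))
++-∈-shW (a ∷ u) (b ∷ v) = ∈-++⁺ˡ (∈-map⁺ (a ∷_) (++-∈-shW u (b ∷ v)))

map-shW : ∀ (r : ℕ → ℕ) u v → map (map r) (shW u v) ≡ shW (map r u) (map r v)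
map-shW r [] v = refl
map-shW r (a ∷ u) [] = refl
map-shW r (a ∷ u) (b ∷ v) =
  trans (map-++ (map r) (map (a ∷_) (shW u (b ∷ v))) _)
        (cong₂ _++_ (prepend a (map-shW r u (b ∷ v))) (prepend b (map-shW r (a ∷ u) v)))
  where
  prepend : ∀ c {X X′} → map (map r) X ≡ X′ → map (map r) (map (c ∷_) X) ≡ map (r c ∷_) X′
  prepend c {X} eq = trans (sym (map-∘ X)) (trans (map-∘ X) (cong (map (r c ∷_)) eq))

shuffleLists : List Word → List Word → List Word
shuffleLists us vs = concatMap (λ u → concatMap (shW u) vs) us

∈-shuffleLists⁺ : ∀ {u v us vs} → u ∈ us → v ∈ vs → u ++ v ∈ shuffleLists us vs
∈-shuffleLists⁺ {u} {v} {vs = vs} u∈us v∈vs =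
  ∈-concatMap⁺ (λ u → concatMap (shW u) vs)
    (lose u∈us (∈-concatMap⁺ (shW u) (lose v∈vs (++-∈-shW u v))))

shuffleLists-↭ : ∀ {us vs s t} → All (_↭ s) us → All (_↭ t) vs →
  ∀ {x} → x ∈ shuffleLists us vs → x ↭ s ++ t
shuffleLists-↭ {us} {vs} us↭s vs↭t x∈
  with find (∈-concatMap⁻ (λ u → concatMap (shW u) vs) {xs = us} x∈)
... | u , u∈us , x∈′ with find (∈-concatMap⁻ (shW u) {xs = vs} x∈′)
... | v , v∈vs , x∈uv = ↭.trans (shW-↭ u v x∈uv) (++⁺ (All.lookup us↭s u∈us) (All.lookup vs↭t v∈vs))

map-shuffleLists : ∀ (r : ℕ → ℕ) us vs →
  map (map r) (shuffleLists us vs) ≡ shuffleLists (map (map r) us) (map (map r) vs)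
map-shuffleLists r us vs = begin
  map (map r) (shuffleLists us vs)
    ≡⟨ map-concatMap (map r) (λ u → concatMap (shW u) vs) us ⟩
  concatMap (λ u → map (map r) (concatMap (shW u) vs)) us
    ≡⟨ concatMap-cong inner us ⟩
  concatMap (λ u → concatMap (shW (map r u)) (map (map r) vs)) us
    ≡⟨ sym (concatMap-map (λ u → concatMap (shW u) (map (map r) vs)) (map r) us) ⟩
  shuffleLists (map (map r) us) (map (map r) vs) ∎
  where
  open ≡-Reasoning
  inner : ∀ u → map (map r) (concatMap (shW u) vs) ≡ concatMap (shW (map r u)) (map (map r) vs)
  inner u = begin
    map (map r) (concatMap (shW u) vs)                ≡⟨ map-concatMap (map r) (shW u) vs ⟩
    concatMap (λ v → map (map r) (shW u v)) vs        ≡⟨ concatMap-cong (map-shW r u) vs ⟩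
    concatMap (λ v → shW (map r u) (map r v)) vs      ≡⟨ sym (concatMap-map (shW (map r u)) (map r) vs) ⟩
    concatMap (shW (map r u)) (map (map r) vs)        ∎

wordSum-ш : ∀ us vs → wordSum us ш wordSum vs ≡ wordSum (shuffleLists us vs)
wordSum-ш [] vs = refl
wordSum-ш (u ∷ us) vs =
  trans (cong₂ _++_ (trans (sym (++-identityʳ _)) (row vs)) (wordSum-ш us vs))
        (sym (map-++ (1ℚ ,_) (concatMap (shW u) vs) (shuffleLists us vs)))
  where
  row : ∀ vs → wordSum (u ∷ []) ш wordSum vs ≡ wordSum (concatMap (shW u) vs)
  row [] = refl
  row (v ∷ vs) = begin
    wordSum (u ∷ []) ш wordSum (v ∷ vs)              ≡⟨ ++-assoc (wordSum (shW u v)) _ [] ⟩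
    wordSum (shW u v) ++ (wordSum (u ∷ []) ш wordSum vs)   ≡⟨ cong (wordSum (shW u v) ++_) (row vs) ⟩
    wordSum (shW u v) ++ wordSum (concatMap (shW u) vs)     ≡⟨ sym (map-++ (1ℚ ,_) (shW u v) _) ⟩
    wordSum (concatMap (shW u) (v ∷ vs))             ∎
    where open ≡-Reasoning

-- Products of two basis elements of F_{N,2}

data Shape : Set where
  concatenation shuffle : Shape

Admissible : Shape → ℕ → ℕ → Set
Admissible concatenation a b = a < b
Admissible shuffle a b = ⊤

admissible? : ∀ s a b → Dec (Admissible s a b)
admissible? concatenation a b = a <? b
admissible? shuffle a b = yes tt

shapeTerms : Shape → ℕ → ℕ → List Word
shapeTerms concatenation a b = (a ∷ b ∷ []) ∷ []
shapeTerms shuffle a b = shW (a ∷ []) (b ∷ [])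

record LyndonMonomial : Set where
  constructor lyndonMonomial
  field
    shape : Shape
    first second : ℕ
    admissible : Admissible shape first second

  terms : List Word
  terms = shapeTerms shape first second

  letters : Word
  letters = first ∷ second ∷ []

open LyndonMonomial

terms-↭ : ∀ m → All (_↭ letters m) (terms m)
terms-↭ (lyndonMonomial concatenation a b _) = ↭.refl ∷ []
terms-↭ (lyndonMonomial shuffle a b _) = All.tabulate (shW-↭ (a ∷ []) (b ∷ []))

letters-∈-terms : ∀ m → letters m ∈ terms m
letters-∈-terms (lyndonMonomial concatenation a b _) = here refl
letters-∈-terms (lyndonMonomial shuffle a b _) = here refl

∈-if-singleton⁻ : ∀ {A : Set} b {x y : A} → x ∈ (if b then y ∷ [] else []) → T b × x ≡ y
∈-if-singleton⁻ true (here x≡y) = tt , x≡y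

∈-lyndonBasis2⁻ : ∀ N {x} → x ∈ lyndonBasis2 N → ∃[ m ] x ≡ wordSum (terms m)
∈-lyndonBasis2⁻ N x∈ with ∈-++⁻ _ x∈
... | inj₁ x∈words with find (∈-concatMap⁻ _ {xs = upTo (suc N)} x∈words)
...   | a , _ , x∈a with ∈-if-singleton⁻ (oddGe3 a ∧ oddGe3 (N ∸ a) ∧ (a <ᵇ N ∸ a)) x∈a
...     | conds , refl = lyndonMonomial concatenation a (N ∸ a) a<b , refl
  where
  a<b : a < N ∸ a
  a<b = <ᵇ⇒< a (N ∸ a) (proj₂ (Equivalence.to (T-∧ {oddGe3 (N ∸ a)})
          (proj₂ (Equivalence.to (T-∧ {oddGe3 a}) conds))))
∈-lyndonBasis2⁻ N x∈ | inj₂ x∈shuffles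
  with find (∈-concatMap⁻ _ {xs = upTo (suc N)} x∈shuffles)
...   | a , _ , x∈a with ∈-if-singleton⁻ (oddGe3 a ∧ oddGe3 (N ∸ a) ∧ (a ≤ᵇ N ∸ a)) x∈a
...     | _ , refl = lyndonMonomial shuffle a (N ∸ a) tt , wordSum-ш ((a ∷ []) ∷ []) ((N ∸ a ∷ []) ∷ [])

Product : Set
Product = LyndonMonomial × LyndonMonomial

productTerms : Product → List Word
productTerms (m , n) = shuffleLists (terms m) (terms n)

productLetters : Product → Word
productLetters (m , n) = letters m ++ letters n

productTerms-↭ : ∀ P {x} → x ∈ productTerms P → x ↭ productLetters P
productTerms-↭ (m , n) = shuffleLists-↭ (terms-↭ m) (terms-↭ n)

productLetters-∈ : ∀ P → productLetters P ∈ productTerms P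
productLetters-∈ (m , n) = ∈-shuffleLists⁺ (letters-∈-terms m) (letters-∈-terms n)

module _ {Q : ℕ → Set} {r : ℕ → ℕ} (r-mono : StrictlyMonotoneOn Q r) where

  renameMonomial : (m : LyndonMonomial) → All Q (letters m) → LyndonMonomial
  renameMonomial (lyndonMonomial concatenation a b a<b) (Qa ∷ Qb ∷ []) =
    lyndonMonomial concatenation (r a) (r b) (r-mono Qa Qb a<b)
  renameMonomial (lyndonMonomial shuffle a b _) _ = lyndonMonomial shuffle (r a) (r b) tt

  terms-rename : ∀ m Qm → terms (renameMonomial m Qm) ≡ map (map r) (terms m)
  terms-rename (lyndonMonomial concatenation a b _) (_ ∷ _ ∷ []) = refl
  terms-rename (lyndonMonomial shuffle a b _) _ = refl

  letters-rename : ∀ m Qm → letters (renameMonomial m Qm) ≡ map r (letters m)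
  letters-rename (lyndonMonomial concatenation a b _) (_ ∷ _ ∷ []) = refl
  letters-rename (lyndonMonomial shuffle a b _) _ = refl

  renameProduct : (P : Product) → All Q (productLetters P) → Product
  renameProduct (m , n) QP =
    renameMonomial m (++⁻ˡ (letters m) QP) , renameMonomial n (++⁻ʳ (letters m) QP)

  productTerms-rename : ∀ P QP → productTerms (renameProduct P QP) ≡ map (map r) (productTerms P)
  productTerms-rename (m , n) QP = trans
    (cong₂ shuffleLists (terms-rename m (++⁻ˡ (letters m) QP)) (terms-rename n (++⁻ʳ (letters m) QP)))
    (sym (map-shuffleLists r (terms m) (terms n)))

  productLetters-rename : ∀ P QP → productLetters (renameProduct P QP) ≡ map r (productLetters P)
  productLetters-rename (m , n) QP = trans
    (cong₂ _++_ (letters-rename m (++⁻ˡ (letters m) QP)) (letters-rename n (++⁻ʳ (letters m) QP)))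
    (sym (map-++ r (letters m) (letters n)))

-- The largest word determines the product

sort-≡⇒↭ : ∀ {xs ys} → sort xs ≡ sort ys → xs ↭ ys
sort-≡⇒↭ {xs} {ys} eq = ↭.trans (↭.↭-sym (sort-↭ xs)) (subst (_↭ ys) (sym eq) (sort-↭ ys))

-- The Lyndon factorisation, built from the right: each letter starts a new factor, and a
-- factor u followed by a larger factor v merges into the Lyndon word u v.
mergeFactor : Word → List Word → List Word
mergeFactor u [] = u ∷ []
mergeFactor u (v ∷ vs) = if does (v ≤ʷ? u) then u ∷ v ∷ vs else mergeFactor (u ++ v) vs

lyndonFactors : Word → List Word
lyndonFactors [] = []
lyndonFactors (x ∷ w) = mergeFactor (x ∷ []) (lyndonFactors w)

shuffleAll : List Word → List Word
shuffleAll [] = [] ∷ []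
shuffleAll (u ∷ us) = concatMap (shW u) (shuffleAll us)

lyndonExpansion : Word → List Word
lyndonExpansion w = sort (shuffleAll (lyndonFactors w))

all-shapes? : {Q : Shape → Set} → (∀ s → Dec (Q s)) → Dec (∀ s → Q s)
all-shapes? Q? = map′ (λ (qc , qs) → λ { concatenation → qc ; shuffle → qs })
                      (λ q → q concatenation , q shuffle)
                      (Q? concatenation ×-dec Q? shuffle)

LeadingWordDetermines : Shape → Shape → ℕ → ℕ → ℕ → ℕ → Set
LeadingWordDetermines s t a b c d = Admissible s a b → Admissible t c d →
  let ws = shuffleLists (shapeTerms s a b) (shapeTerms t c d) in
  sort ws ≡ lyndonExpansion (maxWord ws)

leadingWordDetermines? : ∀ s t a b c d → Dec (LeadingWordDetermines s t a b c d)
leadingWordDetermines? s t a b c d =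
  admissible? s a b →-dec admissible? t c d →-dec ≡-dec (≡-dec _≟_) _ _

leadingWordDetermines-<4 : ∀ s t →
  ∀ {a} → a < 4 → ∀ {b} → b < 4 → ∀ {c} → c < 4 → ∀ {d} → d < 4 → LeadingWordDetermines s t a b c d
leadingWordDetermines-<4 = toWitness {a? = decision} tt
  where
  decision : Dec (∀ s t →
    ∀ {a} → a < 4 → ∀ {b} → b < 4 → ∀ {c} → c < 4 → ∀ {d} → d < 4 → LeadingWordDetermines s t a b c d)
  decision = all-shapes? λ s → all-shapes? λ t →
    allUpTo? (λ a → allUpTo? (λ b → allUpTo? (λ c → allUpTo? (λ d →
      leadingWordDetermines? s t a b c d) 4) 4) 4) 4

leadingWord-determines-smallProduct : ∀ P → All (_< 4) (productLetters P) →
  sort (productTerms P) ≡ lyndonExpansion (maxWord (productTerms P))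
leadingWord-determines-smallProduct
  (lyndonMonomial s a b adm₁ , lyndonMonomial t c d adm₂) (a<4 ∷ b<4 ∷ c<4 ∷ d<4 ∷ []) =
    leadingWordDetermines-<4 s t a<4 b<4 c<4 d<4 adm₁ adm₂

rank : List ℕ → ℕ → ℕ
rank [] x = 0
rank (z ∷ L) x with z <? x
... | yes _ = suc (rank L x)
... | no _ = rank L x

rank-mono : ∀ L {x y} → x ≤ y → rank L x ≤ rank L y
rank-mono [] _ = z≤n
rank-mono (z ∷ L) {x} {y} x≤y with z <? x | z <? y
... | yes _ | yes _ = s≤s (rank-mono L x≤y)
... | no _ | no _ = rank-mono L x≤y
... | no _ | yes _ = m≤n⇒m≤1+n (rank-mono L x≤y)
... | yes z<x | no z≮y = contradiction (<-≤-trans z<x x≤y) z≮y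

rank-strict : ∀ L {x y} → x ∈ L → x < y → rank L x < rank L y
rank-strict (z ∷ L) {x} {y} (here refl) x<y with x <? x | x <? y
... | yes x<x | _ = contradiction x<x (<-irrefl refl)
... | _ | no x≮y = contradiction x<y x≮y
... | no _ | yes _ = s≤s (rank-mono L (<⇒≤ x<y))
rank-strict (z ∷ L) {x} {y} (there x∈L) x<y with z <? x | z <? y
... | yes _ | yes _ = s≤s (rank-strict L x∈L x<y)
... | no _ | no _ = rank-strict L x∈L x<y
... | no _ | yes _ = m≤n⇒m≤1+n (rank-strict L x∈L x<y)
... | yes z<x | no z≮y = contradiction (<-trans z<x x<y) z≮y

rank-strictlyMonotone : ∀ L → StrictlyMonotoneOn (_∈ L) (rank L)
rank-strictlyMonotone L x∈L _ = rank-strict L x∈L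

rank-≤ : ∀ L x → rank L x ≤ length L
rank-≤ [] x = z≤n
rank-≤ (z ∷ L) x with z <? x
... | yes _ = s≤s (rank-≤ L x)
... | no _ = m≤n⇒m≤1+n (rank-≤ L x)

rank-< : ∀ L {x} → x ∈ L → rank L x < length L
rank-< (z ∷ L) {x} (here refl) with x <? x
... | yes x<x = contradiction x<x (<-irrefl refl)
... | no _ = s≤s (rank-≤ L x)
rank-< (z ∷ L) {x} (there x∈L) with z <? x
... | yes _ = s≤s (rank-< L x∈L)
... | no _ = m≤n⇒m≤1+n (rank-< L x∈L)

productTerms-over : ∀ {L} P → L ↭ productLetters P → ∀ {x} → x ∈ productTerms P → All (_∈ L) x
productTerms-over P L↭P x∈ = All.tabulate (∈-resp-↭ (↭.trans (productTerms-↭ P x∈) (↭.↭-sym L↭P)))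

relabelled-product : ∀ {L} P → L ↭ productLetters P → maxWord (productTerms P) ≡ L →
  sort (map (map (rank L)) (productTerms P)) ≡ lyndonExpansion (map (rank L) L)
relabelled-product {L} P L↭P lead≡L = begin
  sort (map (map r) (productTerms P))
    ≡⟨ cong sort (sym (productTerms-rename r-mono P QP)) ⟩
  sort (productTerms P°)
    ≡⟨ leadingWord-determines-smallProduct P° small ⟩
  lyndonExpansion (maxWord (productTerms P°))
    ≡⟨ cong (lyndonExpansion ∘ maxWord) (productTerms-rename r-mono P QP) ⟩
  lyndonExpansion (maxWord (map (map r) (productTerms P)))
    ≡⟨ cong lyndonExpansion (maxWord-map r-mono (All.tabulate (productTerms-over P L↭P))) ⟩
  lyndonExpansion (map r (maxWord (productTerms P)))
    ≡⟨ cong (lyndonExpansion ∘ map r) lead≡L ⟩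
  lyndonExpansion (map r L) ∎
  where
  open ≡-Reasoning
  r : ℕ → ℕ
  r = rank L
  r-mono : StrictlyMonotoneOn (_∈ L) r
  r-mono = rank-strictlyMonotone L
  QP : All (_∈ L) (productLetters P)
  QP = All.tabulate (∈-resp-↭ (↭.↭-sym L↭P))
  P° : Product
  P° = renameProduct r-mono P QP
  small : All (_< 4) (productLetters P°)
  small = subst (All (_< 4)) (sym (productLetters-rename r-mono P QP))
    (All.map⁺ (All.map (λ x∈L → subst (rank L _ <_) (↭-length L↭P) (rank-< L x∈L)) QP))

leadingWord-determines-product : ∀ P P′ → maxWord (productTerms P) ≡ maxWord (productTerms P′) →
  wordSum (productTerms P) ≈P wordSum (productTerms P′)
leadingWord-determines-product P P′ same-lead =
  wordSum-reflects-↭ (map-injectiveOn (strictlyMonotone⇒injective (rank-strictlyMonotone L)))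
    (All.tabulate (productTerms-over P L↭P)) (All.tabulate (productTerms-over P′ L↭P′))
    (sort-≡⇒↭ (trans (relabelled-product P L↭P refl) (sym (relabelled-product P′ L↭P′ (sym same-lead)))))
  where
  L : Word
  L = maxWord (productTerms P)
  L↭P : L ↭ productLetters P
  L↭P = productTerms-↭ P (maxWord-∈ (productLetters-∈ P))
  L↭P′ : L ↭ productLetters P′
  L↭P′ = productTerms-↭ P′
    (subst (_∈ productTerms P′) (sym same-lead) (maxWord-∈ (productLetters-∈ P′)))

leadingWord : Poly → Word
leadingWord p = maxWord (map proj₂ p)

leadingWord-wordSum : ∀ ws → leadingWord (wordSum ws) ≡ maxWord ws
leadingWord-wordSum ws = cong maxWord (trans (sym (map-∘ ws)) (map-id ws))

IsProduct : Poly → Set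
IsProduct p = ∃[ P ] p ≡ wordSum (productTerms P)

products-linIndep : LinIndepSet IsProduct
products-linIndep = linIndep-triangular IsProduct leadingWord lead-coeff lead-max lead-inj
  where
  lead-coeff : ∀ {p} → IsProduct p → coeff p (leadingWord p) ≢ 0ℚ
  lead-coeff (P , refl) = subst (λ w → coeff (wordSum (productTerms P)) w ≢ 0ℚ)
    (sym (leadingWord-wordSum (productTerms P))) (coeff-wordSum-∈ (maxWord-∈ (productLetters-∈ P)))
  lead-max : ∀ {p q} → IsProduct p → IsProduct q →
    coeff q (leadingWord p) ≢ 0ℚ → leadingWord p ≤ʷ leadingWord q
  lead-max _ (Q , refl) c≢0 = subst (_ ≤ʷ_) (sym (leadingWord-wordSum (productTerms Q)))
    (≤-maxWord (coeff-wordSum-≢0⇒∈ (productTerms Q) c≢0))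
  lead-inj : ∀ {p q} → IsProduct p → IsProduct q → leadingWord p ≡ leadingWord q → p ≈P q
  lead-inj (P , refl) (Q , refl) same-lead = leadingWord-determines-product P Q
    (trans (sym (leadingWord-wordSum (productTerms P))) (trans same-lead (leadingWord-wordSum (productTerms Q))))

basis-ш-isProduct : ∀ N₁ N₂ {p} i j →
  p ≡ lookup (lyndonBasis2 N₁) i ш lookup (lyndonBasis2 N₂) j → IsProduct p
basis-ш-isProduct N₁ N₂ i j refl
  with ∈-lyndonBasis2⁻ N₁ (∈-lookup i) | ∈-lyndonBasis2⁻ N₂ (∈-lookup j)
... | m , m≡ | n , n≡ = (m , n) , trans (cong₂ _ш_ m≡ n≡) (wordSum-ш (terms m) (terms n))

mainTheorem13 : (N₁ N₂ : ℕ) → 0 < N₁ → 0 < N₂ →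
    LinIndepSet (λ p → ∃[ i ] ∃[ j ] (p ≡ (lookup (lyndonBasis2 N₁) i ш lookup (lyndonBasis2 N₂) j)))
    × LinIndepSet (λ p → ∃[ i ] ∃[ j ] ((i Fin.≤ j) × (p ≡ (lookup (lyndonBasis2 N₁) i ш lookup (lyndonBasis2 N₁) j))))
mainTheorem13 N₁ N₂ _ _ =
  (λ k v c basis-v → products-linIndep k v c λ l →
    let i , j , vₗ≡ = basis-v l in basis-ш-isProduct N₁ N₂ i j vₗ≡) ,
  (λ k v c basis-v → products-linIndep k v c λ l →
    let i , j , _ , vₗ≡ = basis-v l in basis-ш-isProduct N₁ N₁ i j vₗ≡)
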